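{- Let $P,Q\in\mathcal{L}(n)$ with $\mathrm{atoms}(P)=\mathrm{atoms}(Q)$ (the same labeled atoms $1,\dots,n$). If $P$ covers $Q$ in $\mathcal{L}(n)$, then for every $T\in\mathcal{S}_P\setminus\mathcal{S}_Q$, the element $p\in P$ with $\mathrm{supp}(p)=T$ is meet-irreducible in $P$.
   Context: $\mathcal{L}(n)$ denotes the set of finite atomic lattices (finite lattices with bottom $0$ and top in which every nonzero element is a join of atoms) with $n$ atoms labeled $1,\dots,n$. For $P\in\mathcal{L}(n)$ and $p\in P$, $\mathrm{supp}(p)$ is the set of (labels of) atoms below $p$, and $\mathcal{S}_P=\{\mathrm{supp}(p):p\in P\}$, a family of subsets of $\{1,\dots,n\}$ which, ordered by inclusion, is isomorphic to $P$. $\mathcal{L}(n)$ is partially ordered by: $Q\le P$ iff there exists a join-preserving map from $P$ to $Q$ which is a bijection on atoms (respecting the labels); $P$ covers $Q$ means $Q<P$ and there is no $R$ with $Q<R<P$. An element $x$ of a lattice is meet-irreducible if $x\neq a\wedge b$ for all $a>x$, $b>x$. -}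

module Defs where

open import Data.Nat using (ℕ)
open import Data.Bool using (Bool; true)
open import Data.Fin using (Fin)
open import Data.Fin.Subset using (Subset; _⊆_; _⊂_; _∪_; _∩_; ⁅_⁆; ⊥; ⊤)
open import Data.Product using (Σ; ∃; _×_; _,_)
open import Relation.Nullary using (¬_)
open import Relation.Binary.PropositionalEquality using (_≡_)

Family : ℕ → Set
Family n = Subset n → Bool

_∈𝓢_ : ∀ {n} → Subset n → Family n → Set
A ∈𝓢 S = S A ≡ true

_∉𝓢_ : ∀ {n} → Subset n → Family n → Set
A ∉𝓢 S = ¬ (A ∈𝓢 S)

-- A finite atomic lattice P with atoms labelled by Fin n is represented
-- (up to label-preserving isomorphism) by its support family
-- 𝓢_P = { supp p | p ∈ P }, ordered by inclusion.  Such families are exactly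
-- those containing ∅ (bottom), the full set (top), every singleton (the
-- atoms, distinct and labelled) and closed under intersection (meets).
record AtomicLattice (n : ℕ) : Set where
  field
    𝓢       : Family n
    bot∈    : ⊥ ∈𝓢 𝓢
    top∈    : ⊤ ∈𝓢 𝓢
    atom∈   : ∀ (i : Fin n) → ⁅ i ⁆ ∈𝓢 𝓢
    ∩-closed : ∀ {A B} → A ∈𝓢 𝓢 → B ∈𝓢 𝓢 → (A ∩ B) ∈𝓢 𝓢
open AtomicLattice public

IsJoin : ∀ {n} → AtomicLattice n → Subset n → Subset n → Subset n → Set
IsJoin P A B C =
  C ∈𝓢 𝓢 P × A ⊆ C × B ⊆ C ×
  (∀ D → D ∈𝓢 𝓢 P → A ⊆ D → B ⊆ D → C ⊆ D)

IsMeet : ∀ {n} → AtomicLattice n → Subset n → Subset n → Subset n → Set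
IsMeet P A B C =
  C ∈𝓢 𝓢 P × C ⊆ A × C ⊆ B ×
  (∀ D → D ∈𝓢 𝓢 P → D ⊆ A → D ⊆ B → D ⊆ C)

record JoinHom {n : ℕ} (P Q : AtomicLattice n) : Set where
  field
    f         : Subset n → Subset n
    f-maps    : ∀ A → A ∈𝓢 𝓢 P → f A ∈𝓢 𝓢 Q
    f-join    : ∀ A B C → A ∈𝓢 𝓢 P → B ∈𝓢 𝓢 P →
                IsJoin P A B C → IsJoin Q (f A) (f B) (f C)
    f-atoms   : ∀ (i : Fin n) → f ⁅ i ⁆ ≡ ⁅ i ⁆

_≤𝓛_ : ∀ {n} → AtomicLattice n → AtomicLattice n → Set
Q ≤𝓛 P = JoinHom P Q

-- Equality of elements of 𝓛(n) (isomorphism respecting labels) = same support family.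
_≈𝓛_ : ∀ {n} → AtomicLattice n → AtomicLattice n → Set
Q ≈𝓛 P = ∀ A → (A ∈𝓢 𝓢 Q → A ∈𝓢 𝓢 P) × (A ∈𝓢 𝓢 P → A ∈𝓢 𝓢 Q)

_<𝓛_ : ∀ {n} → AtomicLattice n → AtomicLattice n → Set
Q <𝓛 P = Q ≤𝓛 P × ¬ (Q ≈𝓛 P)

_⋖_ : ∀ {n} → AtomicLattice n → AtomicLattice n → Set
Q ⋖ P = Q <𝓛 P × (∀ R → ¬ (Q <𝓛 R × R <𝓛 P))

MeetIrreducible : ∀ {n : ℕ} → AtomicLattice n → Subset n → Set
MeetIrreducible {n} P X =
  ¬ (Σ (Subset n) λ A → Σ (Subset n) λ B →
       A ∈𝓢 𝓢 P × B ∈𝓢 𝓢 P × X ⊂ A × X ⊂ B × IsMeet P A B X)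

-- Under the support-family description, Q ≤ P in 𝓛(n) means exactly 𝓢_Q ⊆ 𝓢_P
-- (one direction via the closure operator of Q, the other by assembling each
-- X ∈ 𝓢_Q as a P-join of its atoms).  Intermediate lattices are then just
-- intersection-closed families between 𝓢_Q and 𝓢_P.  If P covers Q and
-- T ∈ 𝓢_P ∖ 𝓢_Q, adding to 𝓢_Q all members of 𝓢_P not containing T gives such a
-- family missing T, so it must be 𝓢_Q; hence 𝓢_Q ∪ {T} is intersection-closed,
-- and by the covering it is all of 𝓢_P.  So if T = A ∩ B with A, B ⊋ T in 𝓢_P,
-- then A, B ∈ 𝓢_Q and T ∈ 𝓢_Q, a contradiction.
module Submission where

open import Defs
open import Data.Nat using (ℕ)
open import Data.Bool using (true)
import Data.Bool as Bool
open import Data.Fin using (Fin)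
open import Data.Fin.Subset using (Subset; _⊆_; _⊂_; _∪_; _∩_; ⁅_⁆; _∈_; _∉_; ⊤)
  renaming (⊥ to ∅)
open import Data.Fin.Subset.Properties
open import Data.Vec.Properties using (≡-dec)
open import Data.List using (List; []; _∷_; allFin)
open import Data.List.Relation.Unary.Any using (here; there)
import Data.List.Membership.Propositional as List
open import Data.List.Membership.Propositional.Properties using (∈-allFin)
open import Data.Empty using (⊥; ⊥-elim)
open import Data.Product using (Σ-syntax; _×_; _,_; proj₁; proj₂)
open import Data.Sum using (_⊎_; inj₁; inj₂; [_,_]′)
open import Function using (id; _∘_)
open import Relation.Nullary using (¬_; Dec; yes; no; does; ¬?; contradiction)
open import Relation.Nullary.Decidable using (dec-true; decidable-stable; _×-dec_; _⊎-dec_)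
open import Relation.Binary.PropositionalEquality using (_≡_; _≢_; refl; sym; subst)

module _ {n : ℕ} where

  ⁅x⁆⊆ : ∀ {x} {p : Subset n} → x ∈ p → ⁅ x ⁆ ⊆ p
  ⁅x⁆⊆ {x} x∈p y∈⁅x⁆ = subst (_∈ _) (sym (x∈⁅y⁆⇒x≡y x y∈⁅x⁆)) x∈p

  ⊂⇒≢ : ∀ {p q : Subset n} → p ⊂ q → q ≢ p
  ⊂⇒≢ (_ , x , x∈q , x∉p) refl = x∉p x∈q

  _⊆𝓢_ : Family n → Family n → Set
  S ⊆𝓢 S′ = ∀ A → A ∈𝓢 S → A ∈𝓢 S′

  _∈𝓢?_ : (A : Subset n) (S : Family n) → Dec (A ∈𝓢 S)
  A ∈𝓢? S = S A Bool.≟ true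

  family : {Pr : Subset n → Set} → (∀ A → Dec (Pr A)) → Family n
  family Pr? A = does (Pr? A)

  module _ {Pr : Subset n → Set} (Pr? : ∀ A → Dec (Pr A)) where

    ∈-family⁺ : ∀ {A} → Pr A → A ∈𝓢 family Pr?
    ∈-family⁺ {A} = dec-true (Pr? A)

    ∈-family⁻ : ∀ {A} → A ∈𝓢 family Pr? → Pr A
    ∈-family⁻ {A} A∈ with Pr? A
    ... | yes p = p

  latticeAbove : (L : AtomicLattice n) {Pr : Subset n → Set} (Pr? : ∀ A → Dec (Pr A)) →
                 (∀ A → A ∈𝓢 𝓢 L → Pr A) → (∀ {A B} → Pr A → Pr B → Pr (A ∩ B)) →
                 AtomicLattice n
  latticeAbove L Pr? L⊆Pr Pr-∩ = record
    { 𝓢        = family Pr?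
    ; bot∈     = ∈-family⁺ Pr? (L⊆Pr _ (bot∈ L))
    ; top∈     = ∈-family⁺ Pr? (L⊆Pr _ (top∈ L))
    ; atom∈    = λ i → ∈-family⁺ Pr? (L⊆Pr _ (atom∈ L i))
    ; ∩-closed = λ A∈ B∈ → ∈-family⁺ Pr? (Pr-∩ (∈-family⁻ Pr? A∈) (∈-family⁻ Pr? B∈))
    }

  ∈∉⇒≉ : ∀ {L L′ : AtomicLattice n} {A} → A ∈𝓢 𝓢 L′ → A ∉𝓢 𝓢 L → ¬ (L ≈𝓛 L′)
  ∈∉⇒≉ {A = A} A∈L′ A∉L L≈L′ = A∉L (proj₂ (L≈L′ A) A∈L′)

  IsMeet⇒≡∩ : ∀ {L : AtomicLattice n} {A B X} →
              A ∈𝓢 𝓢 L → B ∈𝓢 𝓢 L → IsMeet L A B X → X ≡ A ∩ B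
  IsMeet⇒≡∩ {L} {A} {B} A∈L B∈L (_ , X⊆A , X⊆B , X-greatest) =
    ⊆-antisym (λ x∈X → x∈p∩q⁺ (X⊆A x∈X , X⊆B x∈X))
              (X-greatest (A ∩ B) (∩-closed L A∈L B∈L) (p∩q⊆p A B) (p∩q⊆q A B))

module Closure {n : ℕ} (L : AtomicLattice n) where

  Separates : Subset n → Fin n → Subset n → Set
  Separates X j Z = Z ∈𝓢 𝓢 L × X ⊆ Z × j ∉ Z

  separates? : ∀ X j Z → Dec (Separates X j Z)
  separates? X j Z = (Z ∈𝓢? 𝓢 L) ×-dec (X ⊆? Z) ×-dec ¬? (j ∈? Z)

  -- For each j in js, intersect with one member of L above X missing j, if any.
  closureOver : (X : Subset n) (js : List (Fin n)) →
    Σ[ Y ∈ Subset n ] Y ∈𝓢 𝓢 L × X ⊆ Y ×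
      (∀ {j} → j List.∈ js → j ∈ Y → ∀ {Z} → Z ∈𝓢 𝓢 L → X ⊆ Z → j ∈ Z)
  closureOver X [] = ⊤ , top∈ L , ⊆⊤ , λ ()
  closureOver X (j ∷ js)
    with closureOver X js | anySubset? (separates? X j)
  ... | Y , Y∈L , X⊆Y , Y-least | yes (Z , Z∈L , X⊆Z , j∉Z) =
    Z ∩ Y , ∩-closed L Z∈L Y∈L , (λ x∈X → x∈p∩q⁺ (X⊆Z x∈X , X⊆Y x∈X)) , λ where
      (here refl)  j∈Z∩Y → contradiction (proj₁ (x∈p∩q⁻ Z Y j∈Z∩Y)) j∉Z
      (there k∈js) k∈Z∩Y → Y-least k∈js (proj₂ (x∈p∩q⁻ Z Y k∈Z∩Y))
  ... | Y , Y∈L , X⊆Y , Y-least | no ¬separated =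
    Y , Y∈L , X⊆Y , λ where
      (here refl) _ {Z} Z∈L X⊆Z →
        decidable-stable (j ∈? Z) λ j∉Z → ¬separated (Z , Z∈L , X⊆Z , j∉Z)
      (there k∈js) → Y-least k∈js

  cl : Subset n → Subset n
  cl X = proj₁ (closureOver X (allFin n))

  cl∈ : ∀ X → cl X ∈𝓢 𝓢 L
  cl∈ X = proj₁ (proj₂ (closureOver X (allFin n)))

  ⊆cl : ∀ X → X ⊆ cl X
  ⊆cl X = proj₁ (proj₂ (proj₂ (closureOver X (allFin n))))

  cl-least : ∀ {X Z} → Z ∈𝓢 𝓢 L → X ⊆ Z → cl X ⊆ Z
  cl-least {X} Z∈L X⊆Z {j} j∈clX =
    proj₂ (proj₂ (proj₂ (closureOver X (allFin n)))) (∈-allFin j) j∈clX Z∈L X⊆Z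

  cl-mono : ∀ {X Y} → X ⊆ Y → cl X ⊆ cl Y
  cl-mono {Y = Y} X⊆Y = cl-least (cl∈ Y) (⊆-trans X⊆Y (⊆cl Y))

  cl-fixes : ∀ {X} → X ∈𝓢 𝓢 L → cl X ≡ X
  cl-fixes {X} X∈L = ⊆-antisym (cl-least X∈L ⊆-refl) (⊆cl X)

  cl-isJoin : ∀ A B → IsJoin L A B (cl (A ∪ B))
  cl-isJoin A B =
    cl∈ _ , ⊆-trans (p⊆p∪q B) (⊆cl _) , ⊆-trans (q⊆p∪q A B) (⊆cl _) ,
    λ Z Z∈L A⊆Z B⊆Z → cl-least Z∈L λ x∈A∪B → [ A⊆Z , B⊆Z ]′ (x∈p∪q⁻ A B x∈A∪B)

  cl-preserves-join : ∀ {R : AtomicLattice n} → 𝓢 L ⊆𝓢 𝓢 R →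
                      ∀ {A B C} → IsJoin R A B C → IsJoin L (cl A) (cl B) (cl C)
  cl-preserves-join L⊆R {A} {B} {C} (_ , A⊆C , B⊆C , C-least) =
    cl∈ C , cl-mono A⊆C , cl-mono B⊆C ,
    λ Z Z∈L clA⊆Z clB⊆Z →
      cl-least Z∈L (C-least Z (L⊆R Z Z∈L) (⊆-trans (⊆cl A) clA⊆Z) (⊆-trans (⊆cl B) clB⊆Z))

⊆𝓢⇒≤𝓛 : ∀ {n} {Q P : AtomicLattice n} → 𝓢 Q ⊆𝓢 𝓢 P → Q ≤𝓛 P
⊆𝓢⇒≤𝓛 {Q = Q} {P} Q⊆P = record
  { f       = cl
  ; f-maps  = λ A _ → cl∈ A
  ; f-join  = λ _ _ _ _ _ → cl-preserves-join {R = P} Q⊆P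
  ; f-atoms = λ i → cl-fixes (atom∈ Q i)
  }
  where open Closure Q

module _ {n : ℕ} {P Q : AtomicLattice n} (Q≤P : Q ≤𝓛 P) where
  open JoinHom Q≤P
  open Closure P

  f-extensive : ∀ {Y} → Y ∈𝓢 𝓢 P → Y ⊆ f Y
  f-extensive {Y} Y∈P {j} j∈Y =
    proj₁ (proj₂ (f-join ⁅ j ⁆ Y Y (atom∈ P j) Y∈P ⁅j⁆∨Y≡Y))
      (subst (j ∈_) (sym (f-atoms j)) (x∈⁅x⁆ j))
    where
    ⁅j⁆∨Y≡Y : IsJoin P ⁅ j ⁆ Y Y
    ⁅j⁆∨Y≡Y = Y∈P , ⁅x⁆⊆ j∈Y , ⊆-refl , λ _ _ _ Y⊆Z → Y⊆Z

  f⁅⁆⊆ : ∀ {j X} → j ∈ X → f ⁅ j ⁆ ⊆ X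
  f⁅⁆⊆ {j} {X} j∈X = subst (_⊆ X) (sym (f-atoms j)) (⁅x⁆⊆ j∈X)

  f-join-below : ∀ {X A B} → X ∈𝓢 𝓢 Q → A ∈𝓢 𝓢 P → B ∈𝓢 𝓢 P →
                 f A ⊆ X → f B ⊆ X → f (cl (A ∪ B)) ⊆ X
  f-join-below {X} {A} {B} X∈Q A∈P B∈P =
    proj₂ (proj₂ (proj₂ (f-join A B _ A∈P B∈P (cl-isJoin A B)))) X X∈Q

  joinAtoms : ∀ {X} → X ∈𝓢 𝓢 Q → (Y : Subset n) → Y ∈𝓢 𝓢 P → f Y ⊆ X →
    (js : List (Fin n)) →
    Σ[ Y′ ∈ Subset n ] Y′ ∈𝓢 𝓢 P × f Y′ ⊆ X × (∀ {j} → j List.∈ js → j ∈ X → j ∈ Y′)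
  joinAtoms X∈Q Y Y∈P fY⊆X [] = Y , Y∈P , fY⊆X , λ ()
  joinAtoms {X} X∈Q Y Y∈P fY⊆X (j ∷ js) with joinAtoms X∈Q Y Y∈P fY⊆X js | j ∈? X
  ... | Y′ , Y′∈P , fY′⊆X , has-js | no j∉X =
    Y′ , Y′∈P , fY′⊆X , λ where
      (here refl) j∈X → contradiction j∈X j∉X
      (there k∈js) → has-js k∈js
  ... | Y′ , Y′∈P , fY′⊆X , has-js | yes j∈X =
    cl (Y′ ∪ ⁅ j ⁆) , cl∈ _ ,
    f-join-below X∈Q Y′∈P (atom∈ P j) fY′⊆X (f⁅⁆⊆ j∈X) ,
    λ where
      (here refl) _ → ⊆cl _ (x∈p∪q⁺ (inj₂ (x∈⁅x⁆ j)))
      (there k∈js) k∈X → ⊆cl _ (x∈p∪q⁺ (inj₁ (has-js k∈js k∈X)))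

  -- The join is started at an atom of X rather than at ∅, since f ∅ need not be ∅.
  ≤𝓛⇒⊆𝓢 : 𝓢 Q ⊆𝓢 𝓢 P
  ≤𝓛⇒⊆𝓢 X X∈Q with nonempty? X
  ... | no X-empty = subst (_∈𝓢 𝓢 P) (sym (Empty-unique X-empty)) (bot∈ P)
  ... | yes (i , i∈X)
    with joinAtoms X∈Q ⁅ i ⁆ (atom∈ P i) (f⁅⁆⊆ i∈X) (allFin n)
  ...   | Y , Y∈P , fY⊆X , has-X =
    subst (_∈𝓢 𝓢 P) (⊆-antisym (⊆-trans (f-extensive Y∈P) fY⊆X) (has-X (∈-allFin _))) Y∈P

module _ {n : ℕ} {P Q : AtomicLattice n} (Q⋖P : Q ⋖ P) where

  ⋖⇒⊆𝓢 : 𝓢 Q ⊆𝓢 𝓢 P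
  ⋖⇒⊆𝓢 = ≤𝓛⇒⊆𝓢 (proj₁ (proj₁ Q⋖P))

  ⋖-no-intermediate : (R : AtomicLattice n) → 𝓢 Q ⊆𝓢 𝓢 R → 𝓢 R ⊆𝓢 𝓢 P →
                      ¬ (Q ≈𝓛 R) → ¬ (R ≈𝓛 P) → ⊥
  ⋖-no-intermediate R Q⊆R R⊆P Q≉R R≉P =
    proj₂ Q⋖P R ((⊆𝓢⇒≤𝓛 Q⊆R , Q≉R) , (⊆𝓢⇒≤𝓛 R⊆P , R≉P))

  module _ {T : Subset n} (T∈P : T ∈𝓢 𝓢 P) (T∉Q : T ∉𝓢 𝓢 Q) where

    InQOrAvoidsT : Subset n → Set
    InQOrAvoidsT Y = Y ∈𝓢 𝓢 Q ⊎ (Y ∈𝓢 𝓢 P × ¬ T ⊆ Y)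

    inQOrAvoidsT? : ∀ Y → Dec (InQOrAvoidsT Y)
    inQOrAvoidsT? Y = (Y ∈𝓢? 𝓢 Q) ⊎-dec ((Y ∈𝓢? 𝓢 P) ×-dec ¬? (T ⊆? Y))

    inQOrAvoidsT⇒∈P : ∀ {Y} → InQOrAvoidsT Y → Y ∈𝓢 𝓢 P
    inQOrAvoidsT⇒∈P = [ ⋖⇒⊆𝓢 _ , proj₁ ]′

    inQOrAvoidsT-∩ : ∀ {C D} → InQOrAvoidsT C → InQOrAvoidsT D → InQOrAvoidsT (C ∩ D)
    inQOrAvoidsT-∩ (inj₁ C∈Q) (inj₁ D∈Q) = inj₁ (∩-closed Q C∈Q D∈Q)
    inQOrAvoidsT-∩ {C} {D} (inj₂ (C∈P , T⊈C)) D-in =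
      inj₂ (∩-closed P C∈P (inQOrAvoidsT⇒∈P D-in) , λ T⊆C∩D → T⊈C (⊆-trans T⊆C∩D (p∩q⊆p C D)))
    inQOrAvoidsT-∩ {C} {D} (inj₁ C∈Q) (inj₂ (D∈P , T⊈D)) =
      inj₂ (∩-closed P (⋖⇒⊆𝓢 C C∈Q) D∈P , λ T⊆C∩D → T⊈D (⊆-trans T⊆C∩D (p∩q⊆q C D)))

    avoidsT⇒∈Q : ∀ {Y} → Y ∈𝓢 𝓢 P → ¬ T ⊆ Y → Y ∈𝓢 𝓢 Q
    avoidsT⇒∈Q {Y} Y∈P T⊈Y = decidable-stable (Y ∈𝓢? 𝓢 Q) λ Y∉Q →
      ⋖-no-intermediate R (λ _ → ∈-family⁺ inQOrAvoidsT? ∘ inj₁)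
        (λ _ → inQOrAvoidsT⇒∈P ∘ ∈-family⁻ inQOrAvoidsT?)
        (∈∉⇒≉ {L = Q} {R} (∈-family⁺ inQOrAvoidsT? (inj₂ (Y∈P , T⊈Y))) Y∉Q)
        (∈∉⇒≉ {L = R} {P} T∈P λ T∈R → [ T∉Q , (λ (_ , T⊈T) → T⊈T ⊆-refl) ]′ (∈-family⁻ inQOrAvoidsT? T∈R))
      where
      R : AtomicLattice n
      R = latticeAbove Q inQOrAvoidsT? (λ _ → inj₁) inQOrAvoidsT-∩

    InQOrT : Subset n → Set
    InQOrT Y = Y ∈𝓢 𝓢 Q ⊎ Y ≡ T

    inQOrT? : ∀ Y → Dec (InQOrT Y)
    inQOrT? Y = (Y ∈𝓢? 𝓢 Q) ⊎-dec ≡-dec Bool._≟_ Y T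

    inQOrT⇒∈P : ∀ {Y} → InQOrT Y → Y ∈𝓢 𝓢 P
    inQOrT⇒∈P = [ ⋖⇒⊆𝓢 _ , (λ { refl → T∈P }) ]′

    T∩-inQOrT : ∀ {D} → D ∈𝓢 𝓢 P → InQOrT (T ∩ D)
    T∩-inQOrT {D} D∈P with T ⊆? D
    ... | yes T⊆D = inj₂ (⊆-antisym (p∩q⊆p T D) (λ x∈T → x∈p∩q⁺ (x∈T , T⊆D x∈T)))
    ... | no T⊈D  = inj₁ (avoidsT⇒∈Q (∩-closed P T∈P D∈P)
                                      (λ T⊆T∩D → T⊈D (⊆-trans T⊆T∩D (p∩q⊆q T D))))

    inQOrT-∩ : ∀ {C D} → InQOrT C → InQOrT D → InQOrT (C ∩ D)
    inQOrT-∩ (inj₁ C∈Q) (inj₁ D∈Q) = inj₁ (∩-closed Q C∈Q D∈Q)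
    inQOrT-∩ (inj₂ refl) D-in       = T∩-inQOrT (inQOrT⇒∈P D-in)
    inQOrT-∩ {C} (inj₁ C∈Q) (inj₂ refl) =
      subst InQOrT (∩-comm T C) (T∩-inQOrT (⋖⇒⊆𝓢 C C∈Q))

    ⋖⇒∈Q⊎≡ : ∀ {Y} → Y ∈𝓢 𝓢 P → Y ∈𝓢 𝓢 Q ⊎ Y ≡ T
    ⋖⇒∈Q⊎≡ {Y} Y∈P = decidable-stable (inQOrT? Y) λ Y∉R →
      ⋖-no-intermediate R (λ _ → ∈-family⁺ inQOrT? ∘ inj₁)
        (λ _ → inQOrT⇒∈P ∘ ∈-family⁻ inQOrT?)
        (∈∉⇒≉ {L = Q} {R} (∈-family⁺ inQOrT? (inj₂ refl)) T∉Q)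
        (∈∉⇒≉ {L = R} {P} Y∈P (Y∉R ∘ ∈-family⁻ inQOrT?))
      where
      R : AtomicLattice n
      R = latticeAbove Q inQOrT? (λ _ → inj₁) inQOrT-∩

theorem4p3 : ∀ (n : ℕ) (P Q : AtomicLattice n) → Q ⋖ P →
    ∀ (T : Subset n) → T ∈𝓢 𝓢 P → T ∉𝓢 𝓢 Q → MeetIrreducible P T
theorem4p3 n P Q Q⋖P T T∈P T∉Q (A , B , A∈P , B∈P , T⊂A , T⊂B , T≡A⊓B) =
  T∉Q (subst (_∈𝓢 𝓢 Q) (sym (IsMeet⇒≡∩ {L = P} A∈P B∈P T≡A⊓B))
                       (∩-closed Q (aboveT⇒∈Q T⊂A A∈P) (aboveT⇒∈Q T⊂B B∈P)))
  where
  aboveT⇒∈Q : ∀ {Y} → T ⊂ Y → Y ∈𝓢 𝓢 P → Y ∈𝓢 𝓢 Q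
  aboveT⇒∈Q T⊂Y Y∈P = [ id , ⊥-elim ∘ ⊂⇒≢ T⊂Y ]′ (⋖⇒∈Q⊎≡ Q⋖P T∈P T∉Q Y∈P)
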